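{- Let $n,d\in\mathbb{N}$ and write $n=a(n-d)+b$ with integers $a\ge0$ and $0\le b<n-d$. If $G$ is a graph on $n$ vertices with minimum degree $\delta(G)\ge d$, then \[ i(G)\le i\bigl(\overline{aK_{n-d}\cup K_b}\bigr)=a(2^{n-d}-1)+2^b. \]
   Context: All graphs are finite and simple. $i(G)$ denotes the number of independent sets of $G$, including the empty set. $\overline{H}$ denotes the complement of the graph $H$, and $aK_{n-d}\cup K_b$ is the disjoint union of $a$ copies of the complete graph $K_{n-d}$ and one copy of $K_b$ (with $K_0$ the empty graph). -}

module Defs where

open import Data.Bool using (Bool; true; false; _∧_; not; if_then_else_)
open import Data.Nat using (ℕ; zero; suc; _/_)
open import Data.Fin using (Fin; toℕ)
open import Data.Fin.Properties using (_≟_)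
open import Data.Fin.Subset using (Subset)
open import Data.Vec using (Vec; []; _∷_; lookup)
open import Data.List using (List; []; _∷_; map; _++_; length; filterᵇ; allFin)
open import Data.Bool.ListAction using (and)
open import Relation.Binary.PropositionalEquality using (_≡_)
open import Relation.Nullary.Decidable using (⌊_⌋)
import Data.Nat as N

record Graph (n : ℕ) : Set where
  field
    adj    : Fin n → Fin n → Bool
    adj-sym : ∀ u v → adj u v ≡ adj v u
    irrefl : ∀ v → adj v v ≡ false
open Graph public

degree : ∀ {n} → Graph n → Fin n → ℕ
degree {n} G v = length (filterᵇ (adj G v) (allFin n))

MinDegreeAtLeast : ∀ {n} → Graph n → ℕ → Set
MinDegreeAtLeast {n} G d = ∀ v → d N.≤ degree G v

allSubsets : ∀ n → List (Subset n)
allSubsets zero    = [] ∷ []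
allSubsets (suc n) = map (false ∷_) (allSubsets n) ++ map (true ∷_) (allSubsets n)

-- S is independent: no two (distinct, since G is loopless) members are adjacent
isIndependent : ∀ {n} → Graph n → Subset n → Bool
isIndependent {n} G S =
  and (map (λ u → and (map (λ v → not (lookup S u ∧ lookup S v ∧ adj G u v)) (allFin n))) (allFin n))

-- i(G): number of independent sets, including the empty set
i : ∀ {n} → Graph n → ℕ
i {n} G = length (filterᵇ (isIndependent G) (allSubsets n))

complement : ∀ {n} → Graph n → Graph n
complement {n} G = record
  { adj    = λ u v → if ⌊ u ≟ v ⌋ then false else not (adj G u v)
  ; adj-sym = symC
  ; irrefl = irrC
  }
  where
  open import Relation.Binary.PropositionalEquality using (refl; sym; cong)
  open import Relation.Nullary using (yes; no)
  symC : ∀ u v → (if ⌊ u ≟ v ⌋ then false else not (adj G u v))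
               ≡ (if ⌊ v ≟ u ⌋ then false else not (adj G v u))
  symC u v with u ≟ v | v ≟ u
  ... | yes _ | yes _ = refl
  ... | yes p | no q  with q (sym p)
  ... | ()
  symC u v | no q | yes p with q (sym p)
  ... | ()
  symC u v | no _ | no _ = cong not (Graph.adj-sym G u v)
  irrC : ∀ v → (if ⌊ v ≟ v ⌋ then false else not (adj G v v)) ≡ false
  irrC v with v ≟ v
  ... | yes _ = refl
  ... | no q with q refl
  ... | ()

-- index of the block containing vertex k when Fin n is cut into consecutive
-- blocks of size m: {0..m-1}, {m..2m-1}, ...  (m = 0 never used in the theorem)
block : ℕ → ℕ → ℕ
block zero    k = k
block (suc m) k = k / suc m

-- The disjoint union of cliques on Fin n whose cliques are the consecutive
-- blocks of size m.  When n = a*m + b with b < m this is  a K_m ∪ K_b.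
cliqueBlocks : (n m : ℕ) → Graph n
cliqueBlocks n m = record
  { adj    = λ u v → if ⌊ u ≟ v ⌋ then false else ⌊ block m (toℕ u) N.≟ block m (toℕ v) ⌋
  ; adj-sym = symB
  ; irrefl = irrB
  }
  where
  open import Relation.Binary.PropositionalEquality using (refl; sym)
  open import Relation.Nullary using (yes; no)
  symB : ∀ u v → (if ⌊ u ≟ v ⌋ then false else ⌊ block m (toℕ u) N.≟ block m (toℕ v) ⌋)
               ≡ (if ⌊ v ≟ u ⌋ then false else ⌊ block m (toℕ v) N.≟ block m (toℕ u) ⌋)
  symB u v with u ≟ v | v ≟ u
  ... | yes _ | yes _ = refl
  ... | yes p | no q  with q (sym p)
  ... | ()
  symB u v | no q | yes p with q (sym p)
  ... | ()
  symB u v | no _ | no _ with block m (toℕ u) N.≟ block m (toℕ v) | block m (toℕ v) N.≟ block m (toℕ u)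
  ... | yes _ | yes _ = refl
  ... | no _  | no _  = refl
  ... | yes p | no q  with q (sym p)
  ... | ()
  symB u v | no _ | no _ | no q | yes p with q (sym p)
  ... | ()
  irrB : ∀ v → (if ⌊ v ≟ v ⌋ then false else ⌊ block m (toℕ v) N.≟ block m (toℕ v) ⌋) ≡ false
  irrB v with v ≟ v
  ... | yes _ = refl
  ... | no q with q refl
  ... | ()

-- Independent sets of G are the cliques of the reflexive relation h u v = not (adj G u v), and
-- δ(G) ≥ d says that every closed h-neighbourhood has at most m = n - d vertices.  The number of
-- cliques inside a vertex set W is bounded by induction on |W|.  Pick v ∈ W lying in the largest
-- number of cliques of W, let U be the h-neighbours of v in W other than v, and t = |U|.  A clique
-- of W avoids the closed neighbourhood N[v], or contains v (one per clique of U), or avoids v but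
-- meets U.  Double counting gives Σ_C |C ∩ U| ≤ t · cl(U) by the choice of v, and every vertex set
-- U satisfies Σ_{C clique of U} (|U| + 2 - 2|C|) ≤ 2^(|U|+1); together these give
-- cl(W) + 1 ≤ cl(W ∖ N[v]) + 2^(t+1).  As t + 1 ≤ m, the arithmetic of a(2^m - 1) + 2^b closes the
-- induction, and the disjoint union of cliques a K_m ∪ K_b has exactly that many cliques.
module Submission where

open import Algebra.Bundles using (CommutativeMonoid)
import Algebra.Properties.CommutativeSemigroup as CommSemigroupProperties
open import Data.Bool using (Bool; true; false; _∧_; _∨_; not; if_then_else_)
open import Data.Bool.ListAction using (all; any)
open import Data.Bool.Properties
  using (∧-zeroʳ; ∧-identityʳ; ∧-idem; ∧-assoc; ∧-conicalˡ; ∧-conicalʳ; ∨-zeroʳ; ∨-distribˡ-∧;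
         not-involutive; ∧-commutativeMonoid)
open import Data.Empty using (⊥-elim)
open import Data.Fin using (Fin; zero; suc; toℕ)
import Data.Fin as Fin
import Data.Fin.Properties as Finₚ
open import Data.Fin.Subset using (Subset)
open import Data.List using (List; []; _∷_; map; _++_; length; filterᵇ; null; tabulate; allFin; iterate)
open import Data.List.Properties using (map-cong; map-tabulate; length-iterate; length-tabulate; tabulate-cong)
open import Data.List.Relation.Unary.All as All using (All; []; _∷_)
open import Data.Nat using (ℕ; zero; suc; _+_; _*_; _∸_; _^_; _≤_; _<_; z≤n; s≤s; _/_; NonZero)
open import Data.Nat.DivMod using (m<n*o⇒m/o<n; m*n/n≡m; /-monoˡ-≤)
open import Data.Nat.Induction using (<-rec)
open import Data.Nat.ListAction using (sum)
open import Data.Nat.Properties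
open import Data.Nat.Tactic.RingSolver using (solve-∀)
open import Data.Product using (∃-syntax; _×_; _,_)
open import Data.Sum using (_⊎_; inj₁; inj₂)
open import Data.Unit using (⊤)
open import Data.Vec using (_∷_; lookup)
open import Function using (_∘_; const; id; _on_)
open import Relation.Binary.Definitions using (DecidableEquality)
open import Relation.Binary.PropositionalEquality
open import Relation.Nullary using (Dec; yes; no; does)
open import Relation.Nullary.Decidable using (dec-true; dec-false; isYes≗does)

open import Defs

private
  module ∧ = CommSemigroupProperties (CommutativeMonoid.commutativeSemigroup ∧-commutativeMonoid)
  module + = CommSemigroupProperties +-commutativeSemigroup

  variable
    A B V : Set
    p q : A → Bool
    x : A
    xs : List A

boolToℕ : Bool → ℕ
boolToℕ true  = 1
boolToℕ false = 0

_∧ₚ_ : (A → Bool) → (A → Bool) → A → Bool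
(p ∧ₚ q) y = p y ∧ q y
infixl 6 _∧ₚ_

notₚ : (A → Bool) → A → Bool
notₚ p y = not (p y)

contradictionᵇ : ∀ {b} {X : Set} → b ≡ false → b ≡ true → X
contradictionᵇ refl ()

countᵇ : (A → Bool) → List A → ℕ
countᵇ p []       = 0
countᵇ p (x ∷ xs) = if p x then suc (countᵇ p xs) else countᵇ p xs

countᵇ≡length∘filterᵇ : ∀ (p : A → Bool) xs → countᵇ p xs ≡ length (filterᵇ p xs)
countᵇ≡length∘filterᵇ p []       = refl
countᵇ≡length∘filterᵇ p (x ∷ xs) with p x
... | true  = cong suc (countᵇ≡length∘filterᵇ p xs)
... | false = countᵇ≡length∘filterᵇ p xs

countᵇ-∷-true : ∀ (p : A → Bool) xs → p x ≡ true → countᵇ p (x ∷ xs) ≡ suc (countᵇ p xs)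
countᵇ-∷-true p xs e rewrite e = refl

countᵇ-∷-false : ∀ (p : A → Bool) xs → p x ≡ false → countᵇ p (x ∷ xs) ≡ countᵇ p xs
countᵇ-∷-false p xs e rewrite e = refl

countᵇ-∷ : ∀ (p : A → Bool) y C → countᵇ p (y ∷ C) ≡ boolToℕ (p y) + countᵇ p C
countᵇ-∷ p y C with p y
... | true  = refl
... | false = refl

countᵇ-congᴬ : All (λ y → p y ≡ q y) xs → countᵇ p xs ≡ countᵇ q xs
countᵇ-congᴬ [] = refl
countᵇ-congᴬ {q = q} {xs = x ∷ _} (e ∷ es) rewrite e with q x
... | true  = cong suc (countᵇ-congᴬ es)
... | false = countᵇ-congᴬ es

countᵇ-cong : ∀ xs → (∀ y → p y ≡ q y) → countᵇ p xs ≡ countᵇ q xs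
countᵇ-cong xs e = countᵇ-congᴬ (All.universal e xs)

countᵇ-none : ∀ xs → All (λ y → p y ≡ false) xs → countᵇ p xs ≡ 0
countᵇ-none []       []       = refl
countᵇ-none {p = p} (_ ∷ xs) (e ∷ es) = trans (countᵇ-∷-false p xs e) (countᵇ-none xs es)

countᵇ≡0⇒none : ∀ (p : A → Bool) xs → countᵇ p xs ≡ 0 → All (λ y → p y ≡ false) xs
countᵇ≡0⇒none p []       _ = []
countᵇ≡0⇒none p (x ∷ xs) e with p x in px
... | false = px ∷ countᵇ≡0⇒none p xs e

countᵇ-mono : ∀ xs → (∀ y → p y ≡ true → q y ≡ true) → countᵇ p xs ≤ countᵇ q xs
countᵇ-mono [] _ = z≤n
countᵇ-mono {p = p} {q = q} (x ∷ xs) p⇒q with p x in px | q x in qx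
... | true  | true  = s≤s (countᵇ-mono xs p⇒q)
... | true  | false = contradictionᵇ qx (p⇒q x px)
... | false | true  = m≤n⇒m≤1+n (countᵇ-mono xs p⇒q)
... | false | false = countᵇ-mono xs p⇒q

-- A strict inclusion of predicates would make the count drop somewhere.
countᵇ-mono-≡⇒agree : ∀ xs → (∀ y → p y ≡ true → q y ≡ true) →
                       countᵇ p xs ≡ countᵇ q xs → All (λ y → p y ≡ q y) xs
countᵇ-mono-≡⇒agree [] _ _ = []
countᵇ-mono-≡⇒agree {p = p} {q = q} (x ∷ xs) p⇒q e with p x in px | q x in qx
... | true  | true  = trans px (sym qx) ∷ countᵇ-mono-≡⇒agree xs p⇒q (suc-injective e)
... | true  | false = contradictionᵇ qx (p⇒q x px)
... | false | true  = ⊥-elim (<-irrefl e (s≤s (countᵇ-mono xs p⇒q)))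
... | false | false = trans px (sym qx) ∷ countᵇ-mono-≡⇒agree xs p⇒q e

countᵇ-split : ∀ (p q : A → Bool) xs → countᵇ p xs ≡ countᵇ (p ∧ₚ q) xs + countᵇ (p ∧ₚ notₚ q) xs
countᵇ-split p q []       = refl
countᵇ-split p q (x ∷ xs) with p x | q x
... | true  | true  = cong suc (countᵇ-split p q xs)
... | true  | false = trans (cong suc (countᵇ-split p q xs)) (sym (+-suc _ _))
... | false | _     = countᵇ-split p q xs

countᵇ-++ : ∀ (p : A → Bool) xs ys → countᵇ p (xs ++ ys) ≡ countᵇ p xs + countᵇ p ys
countᵇ-++ p []       ys = refl
countᵇ-++ p (x ∷ xs) ys with p x
... | true  = cong suc (countᵇ-++ p xs ys)
... | false = countᵇ-++ p xs ys

countᵇ-map : ∀ (p : B → Bool) (g : A → B) xs → countᵇ p (map g xs) ≡ countᵇ (p ∘ g) xs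
countᵇ-map p g []       = refl
countᵇ-map p g (x ∷ xs) with p (g x)
... | true  = cong suc (countᵇ-map p g xs)
... | false = countᵇ-map p g xs

countᵇ-const-true : ∀ (xs : List A) → countᵇ (const true) xs ≡ length xs
countᵇ-const-true []       = refl
countᵇ-const-true (x ∷ xs) = cong suc (countᵇ-const-true xs)

sum-map-+ : ∀ (f g : A → ℕ) xs → sum (map (λ u → f u + g u) xs) ≡ sum (map f xs) + sum (map g xs)
sum-map-+ f g []       = refl
sum-map-+ f g (x ∷ xs) =
  trans (cong (f x + g x +_) (sum-map-+ f g xs)) (+.interchange (f x) (g x) (sum (map f xs)) _)

sum-map-monoᴬ : ∀ {f g : A → ℕ} {xs} → All (λ u → f u ≤ g u) xs → sum (map f xs) ≤ sum (map g xs)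
sum-map-monoᴬ []         = z≤n
sum-map-monoᴬ (le ∷ les) = +-mono-≤ le (sum-map-monoᴬ les)

sum-map-boolToℕ : ∀ (q : A → Bool) xs → sum (map (boolToℕ ∘ q) xs) ≡ countᵇ q xs
sum-map-boolToℕ q []       = refl
sum-map-boolToℕ q (x ∷ xs) with q x
... | true  = cong suc (sum-map-boolToℕ q xs)
... | false = sum-map-boolToℕ q xs

sum-map-if-const : ∀ (q : A → Bool) xs T → sum (map (λ u → if q u then T else 0) xs) ≡ countᵇ q xs * T
sum-map-if-const q []       T = refl
sum-map-if-const q (x ∷ xs) T with q x
... | true  = cong (T +_) (sum-map-if-const q xs T)
... | false = sum-map-if-const q xs T

any+all-not : ∀ (q : A → Bool) C → boolToℕ (any q C) + (if all (notₚ q) C then 1 else 0) ≡ 1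
any+all-not q []      = refl
any+all-not q (x ∷ C) with q x
... | true  = refl
... | false = any+all-not q C

any≤countᵇ : ∀ (q : A → Bool) C → boolToℕ (any q C) ≤ countᵇ q C
any≤countᵇ q []      = z≤n
any≤countᵇ q (y ∷ C) with q y
... | true  = s≤s z≤n
... | false = any≤countᵇ q C

-- Sums over cliques

-- cliqueSum h xs p f sums f C over the sublists C of xs whose members satisfy p and
-- are pairwise h-related; for a symmetric h these are the cliques of h inside p,
-- the empty clique included.
cliqueSum : (V → V → Bool) → List V → (V → Bool) → (List V → ℕ) → ℕ
cliqueSum h []       p f = f []
cliqueSum h (x ∷ xs) p f =
  if p x then cliqueSum h xs p f + cliqueSum h xs (p ∧ₚ h x) (f ∘ (x ∷_)) else cliqueSum h xs p f

cliqueCount : (V → V → Bool) → List V → (V → Bool) → ℕ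
cliqueCount h xs p = cliqueSum h xs p (const 1)

cliqueSizeSum : (V → V → Bool) → List V → (V → Bool) → ℕ
cliqueSizeSum h xs p = cliqueSum h xs p (countᵇ p)

module _ (h : V → V → Bool) where

  cliqueSum-∷-false : ∀ xs (p : V → Bool) f → p x ≡ false → cliqueSum h (x ∷ xs) p f ≡ cliqueSum h xs p f
  cliqueSum-∷-false xs p f e rewrite e = refl

  cliqueSum-cong : ∀ xs (R : V → Set) {p q : V → Bool} {f g : List V → ℕ} → All R xs →
    (∀ y → R y → p y ≡ q y) → (∀ C → All R C → f C ≡ g C) → cliqueSum h xs p f ≡ cliqueSum h xs q g
  cliqueSum-cong [] R _ _ f≡g = f≡g [] []
  cliqueSum-cong (x ∷ xs) R {p} {q} (rx ∷ rxs) p≡q f≡g rewrite p≡q x rx with q x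
  ... | true  = cong₂ _+_ (cliqueSum-cong xs R rxs p≡q f≡g)
                  (cliqueSum-cong xs R rxs (λ y ry → cong (_∧ h x y) (p≡q y ry))
                                           (λ C rC → f≡g (x ∷ C) (rx ∷ rC)))
  ... | false = cliqueSum-cong xs R rxs p≡q f≡g

  cliqueSum-congᴬ : ∀ xs {p q} f → All (λ y → p y ≡ q y) xs → cliqueSum h xs p f ≡ cliqueSum h xs q f
  cliqueSum-congᴬ xs f es = cliqueSum-cong xs _ es (λ _ e → e) (λ _ _ → refl)

  cliqueSum-congᵖ : ∀ xs {p q} f → (∀ y → p y ≡ q y) → cliqueSum h xs p f ≡ cliqueSum h xs q f
  cliqueSum-congᵖ xs f e = cliqueSum-congᴬ xs f (All.universal e xs)

  cliqueSum-congᶠ : ∀ xs p {f g} → (∀ C → f C ≡ g C) → cliqueSum h xs p f ≡ cliqueSum h xs p g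
  cliqueSum-congᶠ xs p e =
    cliqueSum-cong xs (const ⊤) (All.universal _ xs) (λ _ _ → refl) (λ C _ → e C)

  cliqueSum-mono : ∀ xs p {f g} → (∀ C → f C ≤ g C) → cliqueSum h xs p f ≤ cliqueSum h xs p g
  cliqueSum-mono []       p f≤g = f≤g []
  cliqueSum-mono (x ∷ xs) p f≤g with p x
  ... | true  = +-mono-≤ (cliqueSum-mono xs p f≤g) (cliqueSum-mono xs _ (f≤g ∘ (x ∷_)))
  ... | false = cliqueSum-mono xs p f≤g

  cliqueSum-+ : ∀ xs p (f g : List V → ℕ) →
    cliqueSum h xs p (λ C → f C + g C) ≡ cliqueSum h xs p f + cliqueSum h xs p g
  cliqueSum-+ []       p f g = refl
  cliqueSum-+ (x ∷ xs) p f g with p x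
  ... | true  = trans (cong₂ _+_ (cliqueSum-+ xs p f g) (cliqueSum-+ xs _ (f ∘ (x ∷_)) (g ∘ (x ∷_))))
                      (+.interchange (cliqueSum h xs p f) (cliqueSum h xs p g) _ _)
  ... | false = cliqueSum-+ xs p f g

  cliqueSum-zero : ∀ xs p → cliqueSum h xs p (const 0) ≡ 0
  cliqueSum-zero []       p = refl
  cliqueSum-zero (x ∷ xs) p with p x
  ... | true  = cong₂ _+_ (cliqueSum-zero xs p) (cliqueSum-zero xs _)
  ... | false = cliqueSum-zero xs p

  cliqueSum-if : ∀ xs p (b : Bool) (f : List V → ℕ) →
    cliqueSum h xs p (λ C → if b then f C else 0) ≡ (if b then cliqueSum h xs p f else 0)
  cliqueSum-if xs p true  f = refl
  cliqueSum-if xs p false f = cliqueSum-zero xs p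

  cliqueSum-sum : ∀ xs p (K : List A) (g : A → List V → ℕ) →
    cliqueSum h xs p (λ C → sum (map (λ u → g u C) K)) ≡ sum (map (λ u → cliqueSum h xs p (g u)) K)
  cliqueSum-sum xs p []      g = cliqueSum-zero xs p
  cliqueSum-sum xs p (u ∷ K) g =
    trans (cliqueSum-+ xs p (g u) _) (cong (cliqueSum h xs p (g u) +_) (cliqueSum-sum xs p K g))

  cliqueSum-empty : ∀ xs p → cliqueSum h xs p (λ C → boolToℕ (null C)) ≡ 1
  cliqueSum-empty []       p = refl
  cliqueSum-empty (x ∷ xs) p with p x
  ... | true  = cong₂ _+_ (cliqueSum-empty xs p) (cliqueSum-zero xs _)
  ... | false = cliqueSum-empty xs p

  cliqueSum-none : ∀ xs p f → All (λ y → p y ≡ false) xs → cliqueSum h xs p f ≡ f []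
  cliqueSum-none []       p f []       = refl
  cliqueSum-none (x ∷ xs) p f (e ∷ es) = trans (cliqueSum-∷-false xs p f e) (cliqueSum-none xs p f es)

  cliqueSum-restrict : ∀ xs p q (f : List V → ℕ) →
    cliqueSum h xs p (λ C → if all q C then f C else 0) ≡ cliqueSum h xs (p ∧ₚ q) f
  cliqueSum-restrict []       p q f = refl
  cliqueSum-restrict (x ∷ xs) p q f with p x | q x
  ... | true  | true  = cong₂ _+_ (cliqueSum-restrict xs p q f)
                          (trans (cliqueSum-restrict xs (p ∧ₚ h x) q (f ∘ (x ∷_)))
                                 (cliqueSum-congᵖ xs _ (λ y → ∧.xy∙z≈xz∙y (p y) (h x y) (q y))))
  ... | true  | false = trans (cong₂ _+_ (cliqueSum-restrict xs p q f) (cliqueSum-zero xs _)) (+-identityʳ _)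
  ... | false | _     = cliqueSum-restrict xs p q f

  cliqueSum-within : ∀ xs p f → cliqueSum h xs p f ≡ cliqueSum h xs p (λ C → if all p C then f C else 0)
  cliqueSum-within xs p f =
    trans (cliqueSum-congᵖ xs f (λ y → sym (∧-idem (p y)))) (sym (cliqueSum-restrict xs p p f))

  countᵇ-within : ∀ (p q : V → Bool) C → all p C ≡ true → countᵇ q C ≡ countᵇ (p ∧ₚ q) C
  countᵇ-within p q []      _ = refl
  countᵇ-within p q (x ∷ C) e with p x | q x
  ... | true  | true  = cong suc (countᵇ-within p q C e)
  ... | true  | false = countᵇ-within p q C e

  cliqueSum-countᵇ-within : ∀ xs p q → cliqueSum h xs p (countᵇ q) ≡ cliqueSum h xs p (countᵇ (p ∧ₚ q))
  cliqueSum-countᵇ-within xs p q =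
    trans (cliqueSum-within xs p (countᵇ q))
      (trans (cliqueSum-congᶠ xs p (λ C → agree C (all p C) refl))
             (sym (cliqueSum-within xs p (countᵇ (p ∧ₚ q)))))
    where
    agree : ∀ C b → all p C ≡ b → (if b then countᵇ q C else 0) ≡ (if b then countᵇ (p ∧ₚ q) C else 0)
    agree C true  e = countᵇ-within p q C e
    agree C false _ = refl

  cliqueSum-countᵇ-disjoint : ∀ xs p q → (∀ y → (p ∧ₚ q) y ≡ false) → cliqueSum h xs p (countᵇ q) ≡ 0
  cliqueSum-countᵇ-disjoint xs p q disjoint =
    trans (cliqueSum-countᵇ-within xs p q)
          (trans (cliqueSum-congᶠ xs p (λ C → countᵇ-none C (All.universal disjoint C))) (cliqueSum-zero xs p))

  cliqueCount≤2^countᵇ : ∀ xs p → cliqueCount h xs p ≤ 2 ^ countᵇ p xs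
  cliqueCount≤2^countᵇ []       p = ≤-refl
  cliqueCount≤2^countᵇ (x ∷ xs) p with p x
  ... | true  = +-mono-≤ (cliqueCount≤2^countᵇ xs p)
                  (≤-trans (cliqueCount≤2^countᵇ xs (p ∧ₚ h x))
                  (≤-trans (^-monoʳ-≤ 2 (countᵇ-mono xs (λ y → ∧-conicalˡ _ _)))
                           (≤-reflexive (sym (+-identityʳ _)))))
  ... | false = cliqueCount≤2^countᵇ xs p

cliqueSum-congʰ : ∀ {h h′ : A → A → Bool} → (∀ x y → h x y ≡ h′ x y) →
  ∀ xs p f → cliqueSum h xs p f ≡ cliqueSum h′ xs p f
cliqueSum-congʰ           e []       p f = refl
cliqueSum-congʰ {h′ = h′} e (x ∷ xs) p f with p x
... | true  = cong₂ _+_ (cliqueSum-congʰ e xs p f)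
                (trans (cliqueSum-congʰ e xs _ _) (cliqueSum-congᵖ h′ xs _ (λ y → cong (p y ∧_) (e x y))))
... | false = cliqueSum-congʰ e xs p f

cliqueCount-map : ∀ (h : B → B → Bool) (g : A → B) xs p →
  cliqueCount h (map g xs) p ≡ cliqueCount (h on g) xs (p ∘ g)
cliqueCount-map h g []       p = refl
cliqueCount-map h g (x ∷ xs) p with p (g x)
... | true  = cong₂ _+_ (cliqueCount-map h g xs p) (cliqueCount-map h g xs _)
... | false = cliqueCount-map h g xs p

cliqueCount-++ : ∀ (h : A → A → Bool) xs ys p → All (λ x → All (λ y → h x y ≡ false) ys) xs →
  cliqueCount h (xs ++ ys) p + 1 ≡ cliqueCount h xs p + cliqueCount h ys p
cliqueCount-++ h []       ys p []         = +-comm _ 1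
cliqueCount-++ h (x ∷ xs) ys p (x⊥ys ∷ rest) with p x
... | false = cliqueCount-++ h xs ys p rest
... | true  = begin
  cliqueCount h (xs ++ ys) p + cliqueCount h (xs ++ ys) (p ∧ₚ h x) + 1
    ≡⟨ +.xy∙z≈xz∙y (cliqueCount h (xs ++ ys) p) _ 1 ⟩
  cliqueCount h (xs ++ ys) p + 1 + cliqueCount h (xs ++ ys) (p ∧ₚ h x)
    ≡⟨ cong₂ _+_ (cliqueCount-++ h xs ys p rest) through-x ⟩
  cliqueCount h xs p + cliqueCount h ys p + cliqueCount h xs (p ∧ₚ h x)
    ≡⟨ +.xy∙z≈xz∙y (cliqueCount h xs p) _ _ ⟩
  cliqueCount h xs p + cliqueCount h xs (p ∧ₚ h x) + cliqueCount h ys p ∎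
  where
  open ≡-Reasoning
  through-x : cliqueCount h (xs ++ ys) (p ∧ₚ h x) ≡ cliqueCount h xs (p ∧ₚ h x)
  through-x = +-cancelʳ-≡ 1 _ _
    (trans (cliqueCount-++ h xs ys (p ∧ₚ h x) rest)
           (cong (cliqueCount h xs (p ∧ₚ h x) +_)
                 (cliqueSum-none h ys _ (const 1)
                    (All.map (λ {y} e → trans (cong (p y ∧_) e) (∧-zeroʳ (p y))) x⊥ys))))

cliqueCount-complete : ∀ (h : A → A → Bool) (R : A → Set) → (∀ {x y} → R x → R y → h x y ≡ true) →
  ∀ xs → All R xs → cliqueCount h xs (const true) ≡ 2 ^ length xs
cliqueCount-complete h R adjacent []       []         = refl
cliqueCount-complete h R adjacent (x ∷ xs) (rx ∷ rxs) =
  trans (cong (cliqueCount h xs (const true) +_)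
              (cliqueSum-congᴬ h xs (const 1) (All.map (adjacent rx) rxs)))
        (trans (cong (λ k → k + k) (cliqueCount-complete h R adjacent xs rxs))
               (cong (2 ^ length xs +_) (sym (+-identityʳ _))))

SwapInvariant : (List V → ℕ) → Set
SwapInvariant f = ∀ pre x y C → f (pre ++ x ∷ y ∷ C) ≡ f (pre ++ y ∷ x ∷ C)

const-swapInvariant : ∀ k → SwapInvariant {V} (const k)
const-swapInvariant k pre x y C = refl

countᵇ-swapInvariant : ∀ (q : V → Bool) → SwapInvariant (countᵇ q)
countᵇ-swapInvariant q [] x y C with q x | q y
... | true  | true  = refl
... | true  | false = refl
... | false | true  = refl
... | false | false = refl
countᵇ-swapInvariant q (z ∷ pre) x y C with q z
... | true  = cong suc (countᵇ-swapInvariant q pre x y C)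
... | false = countᵇ-swapInvariant q pre x y C

∷-swapInvariant : ∀ {f : List V → ℕ} → SwapInvariant f → ∀ z → SwapInvariant (f ∘ (z ∷_))
∷-swapInvariant sw z pre = sw (z ∷ pre)

module Equalityᵇ {V : Set} (_≟_ : DecidableEquality V) where

  _≡ᵇ_ _≢ᵇ_ : V → V → Bool
  y ≡ᵇ v = does (y ≟ v)
  y ≢ᵇ v = not (y ≡ᵇ v)

  Enumerates : List V → Set
  Enumerates L = ∀ v → countᵇ (_≡ᵇ v) L ≡ 1

  ≡ᵇ-refl : ∀ v → (v ≡ᵇ v) ≡ true
  ≡ᵇ-refl v = dec-true (v ≟ v) refl

  ≡ᵇ-sym : ∀ u y → (u ≡ᵇ y) ≡ (y ≡ᵇ u)
  ≡ᵇ-sym u y with u ≟ y | y ≟ u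
  ... | yes _   | yes _   = refl
  ... | no _    | no _    = refl
  ... | yes u≡y | no y≢u  = ⊥-elim (y≢u (sym u≡y))
  ... | no u≢y  | yes y≡u = ⊥-elim (u≢y (sym y≡u))

  ≢ᵇ-∧-≡ᵇ : ∀ (p : V → Bool) v y → (p ∧ₚ (_≢ᵇ v)) y ∧ (y ≡ᵇ v) ≡ false
  ≢ᵇ-∧-≡ᵇ p v y with y ≟ v
  ... | yes _ = cong (_∧ true) (∧-zeroʳ (p y))
  ... | no _  = ∧-zeroʳ _

  ∧ₚ≢ᵇ-absent : ∀ (p : V → Bool) v xs → All (λ y → (y ≡ᵇ v) ≡ false) xs →
                All (λ y → p y ≡ (p ∧ₚ (_≢ᵇ v)) y) xs
  ∧ₚ≢ᵇ-absent p v xs = All.map (λ {y} e → sym (trans (cong (λ b → p y ∧ not b) e) (∧-identityʳ (p y))))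

  ∧ₚ≢ᵇ-outside : ∀ (p : V → Bool) v → p v ≡ false → ∀ y → p y ≡ (p ∧ₚ (_≢ᵇ v)) y
  ∧ₚ≢ᵇ-outside p v pv y with y ≟ v
  ... | yes refl = trans pv (sym (cong (_∧ false) pv))
  ... | no _     = sym (∧-identityʳ (p y))

  module _ (h : V → V → Bool) (h-sym : ∀ x y → h x y ≡ h y x) where

    -- Cliques avoiding v, plus cliques through v; the latter are listed with v moved to the
    -- front, which is why f has to be SwapInvariant.
    cliqueSum-pivot : ∀ xs p v f → SwapInvariant f → p v ≡ true → countᵇ (_≡ᵇ v) xs ≡ 1 →
      cliqueSum h xs p f ≡ cliqueSum h xs (p ∧ₚ (_≢ᵇ v)) f
                           + cliqueSum h xs (p ∧ₚ h v ∧ₚ (_≢ᵇ v)) (f ∘ (v ∷_))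
    cliqueSum-pivot-∷ : ∀ x xs p v f → SwapInvariant f → p v ≡ true → countᵇ (_≡ᵇ v) (x ∷ xs) ≡ 1 →
      Dec (x ≡ v) →
      cliqueSum h (x ∷ xs) p f ≡ cliqueSum h (x ∷ xs) (p ∧ₚ (_≢ᵇ v)) f
                                 + cliqueSum h (x ∷ xs) (p ∧ₚ h v ∧ₚ (_≢ᵇ v)) (f ∘ (v ∷_))

    cliqueSum-pivot (x ∷ xs) p v f sw pv once = cliqueSum-pivot-∷ x xs p v f sw pv once (x ≟ v)

    cliqueSum-pivot-∷ x xs p .x f sw px once (yes refl) rewrite ≡ᵇ-refl x | px | ∧-zeroʳ (h x x) =
      cong₂ _+_ (cliqueSum-congᴬ h xs f (∧ₚ≢ᵇ-absent p x xs absent))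
                (cliqueSum-congᴬ h xs _ (∧ₚ≢ᵇ-absent (p ∧ₚ h x) x xs absent))
      where
      absent : All (λ y → (y ≡ᵇ x) ≡ false) xs
      absent = countᵇ≡0⇒none (_≡ᵇ x) xs (suc-injective once)
    cliqueSum-pivot-∷ x xs p v f sw pv once (no x≢v) rewrite dec-false (x ≟ v) x≢v with p x in px
    ... | false = cliqueSum-pivot xs p v f sw pv once
    ... | true with h v x in hvx
    ...   | false = begin
      cliqueSum h xs p f + cliqueSum h xs (p ∧ₚ h x) fx
        ≡⟨ cong₂ _+_ (cliqueSum-pivot xs p v f sw pv once)
                     (cliqueSum-congᵖ h xs fx
                        (∧ₚ≢ᵇ-outside (p ∧ₚ h x) v (cong₂ _∧_ pv (trans (h-sym x v) hvx)))) ⟩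
      (avoid + through) + cliqueSum h xs (p ∧ₚ h x ∧ₚ (_≢ᵇ v)) fx
        ≡⟨ cong ((avoid + through) +_)
                (cliqueSum-congᵖ h xs fx (λ y → ∧.xy∙z≈xz∙y (p y) (h x y) (y ≢ᵇ v))) ⟩
      (avoid + through) + avoidₓ
        ≡⟨ +.xy∙z≈xz∙y avoid through avoidₓ ⟩
      (avoid + avoidₓ) + through ∎
      where
      open ≡-Reasoning
      fx = f ∘ (x ∷_)
      avoid = cliqueSum h xs (p ∧ₚ (_≢ᵇ v)) f
      avoidₓ = cliqueSum h xs (p ∧ₚ (_≢ᵇ v) ∧ₚ h x) fx
      through = cliqueSum h xs (p ∧ₚ h v ∧ₚ (_≢ᵇ v)) (f ∘ (v ∷_))
    ...   | true = begin
      cliqueSum h xs p f + cliqueSum h xs (p ∧ₚ h x) fx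
        ≡⟨ cong₂ _+_ (cliqueSum-pivot xs p v f sw pv once)
                     (cliqueSum-pivot xs (p ∧ₚ h x) v fx (∷-swapInvariant {f = f} sw x)
                                      (cong₂ _∧_ pv (trans (h-sym x v) hvx)) once) ⟩
      (avoid + through) + (cliqueSum h xs (p ∧ₚ h x ∧ₚ (_≢ᵇ v)) fx
                           + cliqueSum h xs (p ∧ₚ h x ∧ₚ h v ∧ₚ (_≢ᵇ v)) (fx ∘ (v ∷_)))
        ≡⟨ cong ((avoid + through) +_) (cong₂ _+_
             (cliqueSum-congᵖ h xs fx (λ y → ∧.xy∙z≈xz∙y (p y) (h x y) (y ≢ᵇ v)))
             (cliqueSum-cong h xs (const ⊤) (All.universal _ xs)
                (λ y _ → move-second-last (p y) (h x y) (h v y) (y ≢ᵇ v))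
                (λ C _ → sw [] x v C))) ⟩
      (avoid + through) + (avoidₓ + throughₓ)
        ≡⟨ +.interchange avoid through avoidₓ throughₓ ⟩
      (avoid + avoidₓ) + (through + throughₓ) ∎
      where
      open ≡-Reasoning
      fx = f ∘ (x ∷_)
      avoid = cliqueSum h xs (p ∧ₚ (_≢ᵇ v)) f
      avoidₓ = cliqueSum h xs (p ∧ₚ (_≢ᵇ v) ∧ₚ h x) fx
      through = cliqueSum h xs (p ∧ₚ h v ∧ₚ (_≢ᵇ v)) (f ∘ (v ∷_))
      throughₓ = cliqueSum h xs (p ∧ₚ h v ∧ₚ (_≢ᵇ v) ∧ₚ h x) (f ∘ (v ∷_) ∘ (x ∷_))
      move-second-last : ∀ a b c d → ((a ∧ b) ∧ c) ∧ d ≡ ((a ∧ c) ∧ d) ∧ b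
      move-second-last a b c d =
        trans (cong (_∧ d) (∧.xy∙z≈xz∙y a b c)) (∧.xy∙z≈xz∙y (a ∧ c) b d)

2+k≤2^[1+k] : ∀ k → k + 2 ≤ 2 ^ suc k
2+k≤2^[1+k] zero    = ≤-refl
2+k≤2^[1+k] (suc k) = begin
  suc k + 2             ≡⟨ +-comm 1 (k + 2) ⟩
  k + 2 + 1             ≤⟨ +-monoˡ-≤ 1 (2+k≤2^[1+k] k) ⟩
  2 ^ suc k + 1         ≤⟨ +-monoʳ-≤ (2 ^ suc k) (m^n>0 2 (suc k)) ⟩
  2 ^ suc k + 2 ^ suc k ≡⟨ cong (2 ^ suc k +_) (sym (+-identityʳ (2 ^ suc k))) ⟩
  2 ^ suc (suc k)       ∎
  where open ≤-Reasoning

-- The case a = b + 1 + k of the step: the extra k·T₂ is paid for by k + 2 ≤ 2^(k+1).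
sizeBound-step-< : ∀ b k {T₁ T₂ Z₁ Z₂} →
  (2 + suc (b + k)) * T₁ ≤ 2 * 2 ^ suc (b + k) + 2 * Z₁ → (2 + b) * T₂ ≤ 2 * 2 ^ b + 2 * Z₂ →
  T₁ ≤ 2 ^ suc (b + k) → T₂ ≤ 2 ^ b →
  (2 + suc (suc (b + k))) * (T₁ + T₂) ≤ 2 * 2 ^ suc (suc (b + k)) + 2 * (Z₁ + (T₂ + Z₂))
sizeBound-step-< b k {T₁} {T₂} {Z₁} {Z₂} IH₁ IH₂ T₁≤ T₂≤ rewrite ^-distribˡ-+-* 2 b k = begin
  (2 + suc (suc (b + k))) * (T₁ + T₂)
    ≡⟨ e₁ b k T₁ T₂ ⟩
  ((2 + suc (b + k)) * T₁ + (2 + b) * T₂) + (T₁ + 2 * T₂ + k * T₂)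
    ≤⟨ +-mono-≤ (+-mono-≤ IH₁ IH₂) (+-mono-≤ (+-monoˡ-≤ (2 * T₂) T₁≤) (*-monoʳ-≤ k T₂≤)) ⟩
  (2 * (2 * (P * Q)) + 2 * Z₁ + (2 * P + 2 * Z₂)) + (2 * (P * Q) + 2 * T₂ + k * P)
    ≡⟨ e₂ P Q Z₁ Z₂ T₂ k ⟩
  (6 * (P * Q) + 2 * Z₁ + 2 * Z₂ + 2 * T₂) + (k + 2) * P
    ≤⟨ +-monoʳ-≤ _ (*-monoˡ-≤ P (2+k≤2^[1+k] k)) ⟩
  (6 * (P * Q) + 2 * Z₁ + 2 * Z₂ + 2 * T₂) + (2 * Q) * P
    ≡⟨ e₃ P Q Z₁ Z₂ T₂ ⟩
  2 * (2 * (2 * (P * Q))) + 2 * (Z₁ + (T₂ + Z₂)) ∎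
  where
  open ≤-Reasoning
  P = 2 ^ b
  Q = 2 ^ k
  e₁ : ∀ b k T₁ T₂ → (2 + suc (suc (b + k))) * (T₁ + T₂)
                   ≡ ((2 + suc (b + k)) * T₁ + (2 + b) * T₂) + (T₁ + 2 * T₂ + k * T₂)
  e₁ = solve-∀
  e₂ : ∀ P Q Z₁ Z₂ T₂ k → (2 * (2 * (P * Q)) + 2 * Z₁ + (2 * P + 2 * Z₂)) + (2 * (P * Q) + 2 * T₂ + k * P)
                        ≡ (6 * (P * Q) + 2 * Z₁ + 2 * Z₂ + 2 * T₂) + (k + 2) * P
  e₂ = solve-∀
  e₃ : ∀ P Q Z₁ Z₂ T₂ → (6 * (P * Q) + 2 * Z₁ + 2 * Z₂ + 2 * T₂) + (2 * Q) * P
                      ≡ 2 * (2 * (2 * (P * Q))) + 2 * (Z₁ + (T₂ + Z₂))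
  e₃ = solve-∀

sizeBound-step-≡ : ∀ a {T Z} → (2 + a) * T ≤ 2 * 2 ^ a + 2 * Z →
  (2 + suc a) * (T + T) ≤ 2 * 2 ^ suc a + 2 * (Z + (T + Z))
sizeBound-step-≡ a {T} {Z} IH = begin
  (2 + suc a) * (T + T)             ≡⟨ e₁ a T ⟩
  2 * ((2 + a) * T) + 2 * T         ≤⟨ +-monoˡ-≤ (2 * T) (*-monoʳ-≤ 2 IH) ⟩
  2 * (2 * 2 ^ a + 2 * Z) + 2 * T   ≡⟨ e₂ (2 ^ a) Z T ⟩
  2 * (2 * 2 ^ a) + 2 * (Z + (T + Z)) ∎
  where
  open ≤-Reasoning
  e₁ : ∀ a T → (2 + suc a) * (T + T) ≡ 2 * ((2 + a) * T) + 2 * T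
  e₁ = solve-∀
  e₂ : ∀ P Z T → 2 * (2 * P + 2 * Z) + 2 * T ≡ 2 * (2 * P) + 2 * (Z + (T + Z))
  e₂ = solve-∀

sizeBound-step : ∀ {a b T₁ T₂ Z₁ Z₂} → b ≤ a → (b ≡ a → T₂ ≡ T₁ × Z₂ ≡ Z₁) →
  (2 + a) * T₁ ≤ 2 * 2 ^ a + 2 * Z₁ → (2 + b) * T₂ ≤ 2 * 2 ^ b + 2 * Z₂ → T₁ ≤ 2 ^ a → T₂ ≤ 2 ^ b →
  (2 + suc a) * (T₁ + T₂) ≤ 2 * 2 ^ suc a + 2 * (Z₁ + (T₂ + Z₂))
sizeBound-step {a} {T₁ = T₁} {Z₁ = Z₁} b≤a same IH₁ IH₂ T₁≤ T₂≤ with m≤n⇒m<n∨m≡n b≤a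
... | inj₂ refl with same refl
...   | refl , refl = sizeBound-step-≡ a {T₁} {Z₁} IH₁
sizeBound-step {b = b} {Z₁ = Z₁} {Z₂} b≤a same IH₁ IH₂ T₁≤ T₂≤ | inj₁ b<a with m≤n⇒∃[o]m+o≡n b<a
... | k , refl = sizeBound-step-< b k {Z₁ = Z₁} {Z₂} IH₁ IH₂ T₁≤ T₂≤

module _ (h : V → V → Bool) where

  cliqueSum-suc∘countᵇ : ∀ xs (U : V → Bool) x →
    cliqueSum h xs (U ∧ₚ h x) (suc ∘ countᵇ U) ≡ cliqueCount h xs (U ∧ₚ h x) + cliqueSizeSum h xs (U ∧ₚ h x)
  cliqueSum-suc∘countᵇ xs U x =
    trans (cliqueSum-+ h xs (U ∧ₚ h x) (const 1) (countᵇ U))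
          (cong (cliqueCount h xs (U ∧ₚ h x) +_)
                (trans (cliqueSum-countᵇ-within h xs (U ∧ₚ h x) U)
                       (cliqueSum-congᶠ h xs (U ∧ₚ h x) (λ C → countᵇ-cong C absorb))))
    where
    absorb : ∀ y → (U y ∧ h x y) ∧ U y ≡ U y ∧ h x y
    absorb y = trans (∧.xy∙z≈xz∙y (U y) (h x y) (U y)) (cong (_∧ h x y) (∧-idem (U y)))

  -- Σ_C (|U| + 2 - 2|C|) ≤ 2^(|U|+1) over the cliques C of U, cleared of subtraction.
  cliqueCount-sizeBound : ∀ xs U →
    (2 + countᵇ U xs) * cliqueCount h xs U ≤ 2 * 2 ^ countᵇ U xs + 2 * cliqueSizeSum h xs U
  cliqueCount-sizeBound []       U = ≤-refl
  cliqueCount-sizeBound (x ∷ xs) U with U x in ux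
  ... | false = cliqueCount-sizeBound xs U
  ... | true rewrite cliqueSum-suc∘countᵇ xs U x =
    sizeBound-step (countᵇ-mono xs (λ _ → ∧-conicalˡ _ _)) same-size⇒same-cliques
      (cliqueCount-sizeBound xs U) (cliqueCount-sizeBound xs (U ∧ₚ h x))
      (cliqueCount≤2^countᵇ h xs U) (cliqueCount≤2^countᵇ h xs (U ∧ₚ h x))
    where
    same-size⇒same-cliques : countᵇ (U ∧ₚ h x) xs ≡ countᵇ U xs →
      cliqueCount h xs (U ∧ₚ h x) ≡ cliqueCount h xs U × cliqueSizeSum h xs (U ∧ₚ h x) ≡ cliqueSizeSum h xs U
    same-size⇒same-cliques same =
      cliqueSum-congᴬ h xs (const 1) agree ,
      cliqueSum-cong h xs (λ y → (U ∧ₚ h x) y ≡ U y) agree (λ _ e → e) (λ C → countᵇ-congᴬ)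
      where
      agree : All (λ y → (U ∧ₚ h x) y ≡ U y) xs
      agree = countᵇ-mono-≡⇒agree xs (λ _ → ∧-conicalˡ _ _) same

-- The extremal count a (2^m - 1) + 2^b

x+y≤xy+1 : ∀ {x y} → 1 ≤ x → 1 ≤ y → x + y ≤ x * y + 1
x+y≤xy+1 {suc x} {suc y} _ _ = begin
  suc x + suc y           ≤⟨ m≤n+m (suc x + suc y) (x * y) ⟩
  x * y + (suc x + suc y) ≡⟨ e x y ⟩
  suc x * suc y + 1       ∎
  where
  open ≤-Reasoning
  e : ∀ x y → x * y + (suc x + suc y) ≡ suc x * suc y + 1
  e = solve-∀

2^x+2^y≤2^[x+y]+1 : ∀ x y → 2 ^ x + 2 ^ y ≤ 2 ^ (x + y) + 1
2^x+2^y≤2^[x+y]+1 x y =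
  ≤-trans (x+y≤xy+1 (m^n>0 2 x) (m^n>0 2 y)) (≤-reflexive (cong (_+ 1) (sym (^-distribˡ-+-* 2 x y))))

2^-exchange : ∀ {m b s} → b ≤ s → s ≤ m → 2 ^ (m + b ∸ s) + 2 ^ s ≤ 2 ^ m + 2 ^ b
2^-exchange {m} {b} b≤s s≤m with m≤n⇒∃[o]m+o≡n b≤s
... | c , refl with m≤n⇒∃[o]m+o≡n s≤m
...   | e , refl = begin
  2 ^ (b + c + e + b ∸ (b + c)) + 2 ^ (b + c)
    ≡⟨ cong (λ k → 2 ^ k + 2 ^ (b + c))
            (trans (cong (_∸ (b + c)) (+-assoc (b + c) e b)) (m+n∸m≡n (b + c) (e + b))) ⟩
  2 ^ (e + b) + 2 ^ (b + c)
    ≡⟨ cong₂ _+_ (^-distribˡ-+-* 2 e b) (^-distribˡ-+-* 2 b c) ⟩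
  R * P + P * Q
    ≡⟨ e₁ P Q R ⟩
  P * (Q + R)
    ≤⟨ *-monoʳ-≤ P (2^x+2^y≤2^[x+y]+1 c e) ⟩
  P * (2 ^ (c + e) + 1)
    ≡⟨ cong (λ k → P * (k + 1)) (^-distribˡ-+-* 2 c e) ⟩
  P * (Q * R + 1)
    ≡⟨ e₂ P Q R ⟩
  P * Q * R + P
    ≡⟨ cong (_+ P) (sym (trans (^-distribˡ-+-* 2 (b + c) e) (cong (_* R) (^-distribˡ-+-* 2 b c)))) ⟩
  2 ^ (b + c + e) + 2 ^ b ∎
  where
  open ≤-Reasoning
  P = 2 ^ b
  Q = 2 ^ c
  R = 2 ^ e
  e₁ : ∀ P Q R → R * P + P * Q ≡ P * (Q + R)
  e₁ = solve-∀
  e₂ : ∀ P Q R → P * (Q * R + 1) ≡ P * Q * R + P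
  e₂ = solve-∀

-- The number of cliques, the empty one included, of a copies of K_m next to one K_b.
blockCliques : ℕ → ℕ → ℕ → ℕ
blockCliques m a b = a * (2 ^ m ∸ 1) + 2 ^ b

-- Removing s ≤ m vertices either shrinks the partial block (s ≤ b) or breaks up a full one.
blockCliques-peel : ∀ m a b s r → s ≤ m → b < m → s + r ≡ a * m + b →
  ∃[ a′ ] ∃[ b′ ] r ≡ a′ * m + b′ × b′ < m × blockCliques m a′ b′ + 2 ^ s ≤ blockCliques m a b + 1
blockCliques-peel m a b s r s≤m b<m split with s ≤? b
... | yes s≤b = a , b ∸ s , r≡ , ≤-<-trans (m∸n≤m b s) b<m , step
  where
  r≡ : r ≡ a * m + (b ∸ s)
  r≡ = trans (sym (m+n∸m≡n s r)) (trans (cong (_∸ s) split) (+-∸-assoc (a * m) s≤b))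
  step : a * (2 ^ m ∸ 1) + 2 ^ (b ∸ s) + 2 ^ s ≤ a * (2 ^ m ∸ 1) + 2 ^ b + 1
  step = begin
    a * (2 ^ m ∸ 1) + 2 ^ (b ∸ s) + 2 ^ s   ≡⟨ +-assoc (a * (2 ^ m ∸ 1)) _ _ ⟩
    a * (2 ^ m ∸ 1) + (2 ^ (b ∸ s) + 2 ^ s) ≤⟨ +-monoʳ-≤ (a * (2 ^ m ∸ 1)) (2^x+2^y≤2^[x+y]+1 (b ∸ s) s) ⟩
    a * (2 ^ m ∸ 1) + (2 ^ (b ∸ s + s) + 1) ≡⟨ cong (λ k → a * (2 ^ m ∸ 1) + (2 ^ k + 1)) (m∸n+n≡m s≤b) ⟩
    a * (2 ^ m ∸ 1) + (2 ^ b + 1)           ≡⟨ sym (+-assoc (a * (2 ^ m ∸ 1)) _ _) ⟩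
    a * (2 ^ m ∸ 1) + 2 ^ b + 1             ∎
    where open ≤-Reasoning
... | no s≰b with a
...   | zero   = ⊥-elim (s≰b (≤-trans (m≤m+n s r) (≤-reflexive split)))
...   | suc a′ = a′ , m + b ∸ s , r≡ , b′<m , step
  where
  s≤m+b : s ≤ m + b
  s≤m+b = ≤-trans s≤m (m≤m+n m b)
  b<s : b < s
  b<s = ≰⇒> s≰b
  r≡ : r ≡ a′ * m + (m + b ∸ s)
  r≡ = begin-equality
    r                      ≡⟨ sym (m+n∸m≡n s r) ⟩
    s + r ∸ s              ≡⟨ cong (_∸ s) split ⟩
    m + a′ * m + b ∸ s     ≡⟨ cong (_∸ s) (+.xy∙z≈y∙xz m (a′ * m) b) ⟩
    a′ * m + (m + b) ∸ s   ≡⟨ +-∸-assoc (a′ * m) s≤m+b ⟩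
    a′ * m + (m + b ∸ s)   ∎
    where open ≤-Reasoning
  b′<m : m + b ∸ s < m
  b′<m = subst (m + b ∸ s <_) (m+n∸n≡m m s) (∸-monoˡ-< (+-monoʳ-< m b<s) s≤m+b)
  step : a′ * (2 ^ m ∸ 1) + 2 ^ (m + b ∸ s) + 2 ^ s ≤ (2 ^ m ∸ 1) + a′ * (2 ^ m ∸ 1) + 2 ^ b + 1
  step = begin
    a′ * K + 2 ^ (m + b ∸ s) + 2 ^ s   ≡⟨ +-assoc (a′ * K) _ _ ⟩
    a′ * K + (2 ^ (m + b ∸ s) + 2 ^ s) ≤⟨ +-monoʳ-≤ (a′ * K) (2^-exchange (<⇒≤ b<s) s≤m) ⟩
    a′ * K + (2 ^ m + 2 ^ b)           ≡⟨ cong (λ k → a′ * K + (k + 2 ^ b)) (sym (m∸n+n≡m (m^n>0 2 m))) ⟩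
    a′ * K + (K + 1 + 2 ^ b)           ≡⟨ e (a′ * K) K (2 ^ b) ⟩
    K + a′ * K + 2 ^ b + 1             ∎
    where
    open ≤-Reasoning
    K = 2 ^ m ∸ 1
    e : ∀ x k y → x + (k + 1 + y) ≡ k + x + y + 1
    e = solve-∀

-- Peeling off a closed neighbourhood

meets+inside+empty≤countᵇ : ∀ (q : A → Bool) C →
  boolToℕ (any q C) + ((if all q C then countᵇ q C else 0) + boolToℕ (null C))
    ≤ countᵇ q C + (if all q C then 1 else 0)
meets+inside+empty≤countᵇ q []      = ≤-refl
meets+inside+empty≤countᵇ q (x ∷ C) with q x
... | false = ≤-trans (≤-reflexive (+-identityʳ _)) (≤-trans (any≤countᵇ q C) (m≤m+n _ _))
... | true with all q C
...   | true  = ≤-reflexive (trans (cong suc (+-identityʳ (suc (countᵇ q C)))) (+-comm 1 (suc (countᵇ q C))))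
...   | false = s≤s z≤n

peel-arith : ∀ c X T Z S t P → X + Z + 1 ≤ S + T → S + Z ≤ t * T → (2 + t) * T ≤ 2 * P + 2 * Z →
             (c + X + T) + 1 ≤ c + 2 * P
peel-arith c X T Z S t P meet overlapping size = +-cancelʳ-≤ (2 * Z) _ _ (begin
  (c + X + T) + 1 + 2 * Z ≡⟨ e₁ c X T Z ⟩
  c + (X + Z + 1) + (Z + T) ≤⟨ +-monoˡ-≤ (Z + T) (+-monoʳ-≤ c meet) ⟩
  c + (S + T) + (Z + T)     ≡⟨ e₂ c S T Z ⟩
  c + (S + Z) + 2 * T       ≤⟨ +-monoˡ-≤ (2 * T) (+-monoʳ-≤ c overlapping) ⟩
  c + t * T + 2 * T         ≡⟨ e₃ c t T ⟩
  c + (2 + t) * T           ≤⟨ +-monoʳ-≤ c size ⟩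
  c + (2 * P + 2 * Z)       ≡⟨ sym (+-assoc c (2 * P) (2 * Z)) ⟩
  c + 2 * P + 2 * Z         ∎)
  where
  open ≤-Reasoning
  e₁ : ∀ c X T Z → (c + X + T) + 1 + 2 * Z ≡ c + (X + Z + 1) + (Z + T)
  e₁ = solve-∀
  e₂ : ∀ c S T Z → c + (S + T) + (Z + T) ≡ c + (S + Z) + 2 * T
  e₂ = solve-∀
  e₃ : ∀ c t T → c + t * T + 2 * T ≡ c + (2 + t) * T
  e₃ = solve-∀

maximiser : (W : A → Bool) (f : A → ℕ) (xs : List A) →
  All (λ y → W y ≡ false) xs ⊎ ∃[ v ] W v ≡ true × All (λ u → W u ≡ true → f u ≤ f v) xs
maximiser W f []       = inj₁ []
maximiser W f (x ∷ xs) with W x in wx | maximiser W f xs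
... | false | inj₁ none              = inj₁ (wx ∷ none)
... | false | inj₂ (v , wv , bigger) = inj₂ (v , wv , (contradictionᵇ wx) ∷ bigger)
... | true  | inj₁ none              =
  inj₂ (x , wx , (λ _ → ≤-refl) ∷ All.map contradictionᵇ none)
... | true  | inj₂ (v , wv , bigger) with f x ≤? f v
...   | yes fx≤fv = inj₂ (v , wv , (λ _ → fx≤fv) ∷ bigger)
...   | no  fx≰fv =
  inj₂ (x , wx , (λ _ → ≤-refl) ∷ All.map (λ le wu → ≤-trans (le wu) (<⇒≤ (≰⇒> fx≰fv))) bigger)

module Peeling {V : Set} (_≟_ : DecidableEquality V) (h : V → V → Bool)
               (h-sym : ∀ x y → h x y ≡ h y x) (h-refl : ∀ x → h x x ≡ true)
               (L : List V) (L-once : Equalityᵇ.Enumerates _≟_ L) where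

  open Equalityᵇ _≟_

  cliquesThrough : (V → Bool) → V → ℕ
  cliquesThrough W u = cliqueSum h L W (countᵇ (_≡ᵇ u))

  countᵇ≤Σ-multiplicity : ∀ (U : V → Bool) C →
    countᵇ U C ≤ sum (map (λ u → if U u then countᵇ (_≡ᵇ u) C else 0) L)
  countᵇ≤Σ-multiplicity U []      = z≤n
  countᵇ≤Σ-multiplicity U (y ∷ C) = begin
    countᵇ U (y ∷ C)                   ≡⟨ countᵇ-∷ U y C ⟩
    boolToℕ (U y) + countᵇ U C         ≤⟨ +-mono-≤ only-y (countᵇ≤Σ-multiplicity U C) ⟩
    sum (map (λ u → boolToℕ (U u ∧ (y ≡ᵇ u))) L) + sum (map (λ u → if U u then countᵇ (_≡ᵇ u) C else 0) L)
      ≡⟨ sym (sum-map-+ _ _ L) ⟩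
    sum (map (λ u → boolToℕ (U u ∧ (y ≡ᵇ u)) + (if U u then countᵇ (_≡ᵇ u) C else 0)) L)
      ≡⟨ cong sum (map-cong step L) ⟩
    sum (map (λ u → if U u then countᵇ (_≡ᵇ u) (y ∷ C) else 0) L) ∎
    where
    open ≤-Reasoning
    step : ∀ u → boolToℕ (U u ∧ (y ≡ᵇ u)) + (if U u then countᵇ (_≡ᵇ u) C else 0)
               ≡ (if U u then countᵇ (_≡ᵇ u) (y ∷ C) else 0)
    step u with U u
    ... | true  = sym (countᵇ-∷ (_≡ᵇ u) y C)
    ... | false = refl
    only-y : boolToℕ (U y) ≤ sum (map (λ u → boolToℕ (U u ∧ (y ≡ᵇ u))) L)
    only-y with U y in uy
    ... | false = z≤n
    ... | true  = ≤-reflexive (sym (trans (sum-map-boolToℕ (U ∧ₚ (y ≡ᵇ_)) L)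
                                          (trans (countᵇ-cong L at-y) (L-once y))))
      where
      at-y : ∀ u → U u ∧ (y ≡ᵇ u) ≡ (u ≡ᵇ y)
      at-y u with u ≟ y
      ... | yes refl = trans (cong (_∧ _) uy) (≡ᵇ-refl u)
      ... | no u≢y   = trans (cong (U u ∧_) (trans (≡ᵇ-sym y u) (dec-false (u ≟ y) u≢y))) (∧-zeroʳ (U u))

  module Around (W : V → Bool) (v : V) (wv : W v ≡ true) where

    U W⁻ Far : V → Bool
    U   = W ∧ₚ h v ∧ₚ (_≢ᵇ v)
    W⁻  = W ∧ₚ (_≢ᵇ v)
    Far = W ∧ₚ notₚ (h v)

    T Z S⁻ meeting : ℕ
    T       = cliqueCount h L U
    Z       = cliqueSizeSum h L U
    S⁻      = cliqueSum h L W⁻ (countᵇ U)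
    meeting = cliqueSum h L W⁻ (boolToℕ ∘ any U)

    U-v : U v ≡ false
    U-v = trans (cong (λ b → (W v ∧ h v v) ∧ not b) (≡ᵇ-refl v)) (∧-zeroʳ _)

    W⁻∧U≗U : ∀ y → (W⁻ ∧ₚ U) y ≡ U y
    W⁻∧U≗U y = lemma (W y) (h v y) (y ≢ᵇ v)
      where
      lemma : ∀ a b c → (a ∧ c) ∧ ((a ∧ b) ∧ c) ≡ (a ∧ b) ∧ c
      lemma false b c = refl
      lemma true  b false = sym (∧-zeroʳ b)
      lemma true  b true  = refl

    W⁻∖U≗Far : ∀ y → (W⁻ ∧ₚ notₚ U) y ≡ Far y
    W⁻∖U≗Far y with y ≟ v
    ... | yes refl rewrite h-refl y | wv = refl
    ... | no _ with W y | h v y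
    ...   | true  | true  = refl
    ...   | true  | false = refl
    ...   | false | _     = refl

    cliqueCount-decompose : cliqueCount h L W ≡ cliqueCount h L Far + meeting + T
    cliqueCount-decompose = begin
      cliqueCount h L W
        ≡⟨ cliqueSum-pivot h h-sym L W v (const 1) (const-swapInvariant 1) wv (L-once v) ⟩
      cliqueCount h L W⁻ + T
        ≡⟨ cong (_+ T) (cliqueSum-congᶠ h L W⁻ (λ C → sym (any+all-not U C))) ⟩
      cliqueSum h L W⁻ (λ C → boolToℕ (any U C) + (if all (notₚ U) C then 1 else 0)) + T
        ≡⟨ cong (_+ T) (cliqueSum-+ h L W⁻ _ _) ⟩
      meeting + cliqueSum h L W⁻ (λ C → if all (notₚ U) C then 1 else 0) + T
        ≡⟨ cong (λ n → meeting + n + T) (trans (cliqueSum-restrict h L W⁻ (notₚ U) (const 1))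
                                                 (cliqueSum-congᵖ h L (const 1) W⁻∖U≗Far)) ⟩
      meeting + cliqueCount h L Far + T
        ≡⟨ cong (_+ T) (+-comm meeting _) ⟩
      cliqueCount h L Far + meeting + T ∎
      where open ≡-Reasoning

    cliquesThrough-v : cliquesThrough W v ≡ T
    cliquesThrough-v = begin
      cliquesThrough W v
        ≡⟨ cliqueSum-pivot h h-sym L W v (countᵇ (_≡ᵇ v)) (countᵇ-swapInvariant (_≡ᵇ v)) wv (L-once v) ⟩
      cliqueSum h L W⁻ (countᵇ (_≡ᵇ v)) + cliqueSum h L U (countᵇ (_≡ᵇ v) ∘ (v ∷_))
        ≡⟨ cong₂ _+_ (cliqueSum-countᵇ-disjoint h L W⁻ (_≡ᵇ v) (≢ᵇ-∧-≡ᵇ W v))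
                     (cliqueSum-congᶠ h L U (λ C → countᵇ-∷-true (_≡ᵇ v) C (≡ᵇ-refl v))) ⟩
      cliqueSum h L U (suc ∘ countᵇ (_≡ᵇ v))
        ≡⟨ cliqueSum-+ h L U (const 1) (countᵇ (_≡ᵇ v)) ⟩
      T + cliqueSum h L U (countᵇ (_≡ᵇ v))
        ≡⟨ cong (T +_) (cliqueSum-countᵇ-disjoint h L U (_≡ᵇ v) (≢ᵇ-∧-≡ᵇ (W ∧ₚ h v) v)) ⟩
      T + 0
        ≡⟨ +-identityʳ T ⟩
      T ∎
      where open ≡-Reasoning

    overlap-decompose : cliqueSum h L W (countᵇ U) ≡ S⁻ + Z
    overlap-decompose =
      trans (cliqueSum-pivot h h-sym L W v (countᵇ U) (countᵇ-swapInvariant U) wv (L-once v))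
            (cong (S⁻ +_) (cliqueSum-congᶠ h L U (λ C → countᵇ-∷-false U C U-v)))

    meeting-bound : meeting + Z + 1 ≤ S⁻ + T
    meeting-bound = begin
      meeting + Z + 1
        ≡⟨ +-assoc meeting Z 1 ⟩
      meeting + (Z + 1)
        ≡⟨ cong₂ (λ a b → meeting + (a + b))
             (sym (trans (cliqueSum-restrict h L W⁻ U (countᵇ U)) (cliqueSum-congᵖ h L (countᵇ U) W⁻∧U≗U)))
             (sym (cliqueSum-empty h L W⁻)) ⟩
      meeting + (cliqueSum h L W⁻ inside + cliqueSum h L W⁻ (boolToℕ ∘ null))
        ≡⟨ cong (meeting +_) (sym (cliqueSum-+ h L W⁻ _ _)) ⟩
      meeting + cliqueSum h L W⁻ (λ C → inside C + boolToℕ (null C))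
        ≡⟨ sym (cliqueSum-+ h L W⁻ _ _) ⟩
      cliqueSum h L W⁻ (λ C → boolToℕ (any U C) + (inside C + boolToℕ (null C)))
        ≤⟨ cliqueSum-mono h L W⁻ (meets+inside+empty≤countᵇ U) ⟩
      cliqueSum h L W⁻ (λ C → countᵇ U C + (if all U C then 1 else 0))
        ≡⟨ cliqueSum-+ h L W⁻ _ _ ⟩
      S⁻ + cliqueSum h L W⁻ (λ C → if all U C then 1 else 0)
        ≡⟨ cong (S⁻ +_) (trans (cliqueSum-restrict h L W⁻ U (const 1))
                                (cliqueSum-congᵖ h L (const 1) W⁻∧U≗U)) ⟩
      S⁻ + T ∎
      where
      open ≤-Reasoning
      inside : List V → ℕ
      inside C = if all U C then countᵇ U C else 0

    overlap-bound : All (λ u → W u ≡ true → cliquesThrough W u ≤ cliquesThrough W v) L →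
                    S⁻ + Z ≤ countᵇ U L * T
    overlap-bound maximal = begin
      S⁻ + Z
        ≡⟨ sym overlap-decompose ⟩
      cliqueSum h L W (countᵇ U)
        ≤⟨ cliqueSum-mono h L W (countᵇ≤Σ-multiplicity U) ⟩
      cliqueSum h L W (λ C → sum (map (λ u → if U u then countᵇ (_≡ᵇ u) C else 0) L))
        ≡⟨ cliqueSum-sum h L W L (λ u C → if U u then countᵇ (_≡ᵇ u) C else 0) ⟩
      sum (map (λ u → cliqueSum h L W (λ C → if U u then countᵇ (_≡ᵇ u) C else 0)) L)
        ≡⟨ cong sum (map-cong (λ u → cliqueSum-if h L W (U u) (countᵇ (_≡ᵇ u))) L) ⟩
      sum (map (λ u → if U u then cliquesThrough W u else 0) L)
        ≤⟨ sum-map-monoᴬ (All.map at-most-T maximal) ⟩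
      sum (map (λ u → if U u then T else 0) L)
        ≡⟨ sum-map-if-const U L T ⟩
      countᵇ U L * T ∎
      where
      open ≤-Reasoning
      at-most-T : ∀ {u} → (W u ≡ true → cliquesThrough W u ≤ cliquesThrough W v) →
                  (if U u then cliquesThrough W u else 0) ≤ (if U u then T else 0)
      at-most-T {u} le with U u in uu
      ... | false = z≤n
      ... | true  = ≤-trans (le (∧-conicalˡ _ _ (∧-conicalˡ _ _ uu))) (≤-reflexive cliquesThrough-v)

    closedNeighbourhood-size : countᵇ (W ∧ₚ h v) L ≡ suc (countᵇ U L)
    closedNeighbourhood-size =
      trans (countᵇ-split (W ∧ₚ h v) (_≢ᵇ v) L)
            (trans (cong (countᵇ U L +_) (trans (countᵇ-cong L only-v) (L-once v))) (+-comm _ 1))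
      where
      only-v : ∀ y → (W ∧ₚ h v ∧ₚ notₚ (_≢ᵇ v)) y ≡ (y ≡ᵇ v)
      only-v y with y ≟ v
      ... | yes refl rewrite wv | h-refl y = refl
      ... | no _     = ∧-zeroʳ _

    W-size : countᵇ W L ≡ suc (countᵇ U L) + countᵇ Far L
    W-size = trans (countᵇ-split W (h v) L) (cong (_+ countᵇ Far L) closedNeighbourhood-size)

  peel : ∀ {m} → (∀ v → countᵇ (h v) L ≤ m) → ∀ W →
    All (λ y → W y ≡ false) L ⊎
    ∃[ W′ ] ∃[ t ] suc t ≤ m × countᵇ W L ≡ suc t + countᵇ W′ L ×
                   cliqueCount h L W + 1 ≤ cliqueCount h L W′ + 2 ^ suc t
  peel degree W with maximiser W (cliquesThrough W) L
  ... | inj₁ empty               = inj₁ empty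
  ... | inj₂ (v , wv , maximal) = inj₂ (Far , countᵇ U L , closed≤m , W-size , peeled)
    where
    open Around W v wv
    closed≤m : suc (countᵇ U L) ≤ _
    closed≤m = ≤-trans (≤-reflexive (sym closedNeighbourhood-size))
                       (≤-trans (countᵇ-mono L (λ _ → ∧-conicalʳ _ _)) (degree v))
    peeled : cliqueCount h L W + 1 ≤ cliqueCount h L Far + 2 ^ suc (countᵇ U L)
    peeled = subst (λ n → n + 1 ≤ cliqueCount h L Far + 2 ^ suc (countᵇ U L)) (sym cliqueCount-decompose)
               (peel-arith (cliqueCount h L Far) meeting T Z S⁻ (countᵇ U L) (2 ^ countᵇ U L)
                 meeting-bound (overlap-bound maximal) (cliqueCount-sizeBound h L U))

  cliqueCount≤blockCliques : ∀ {m} → (∀ v → countᵇ (h v) L ≤ m) →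
    ∀ W a b → countᵇ W L ≡ a * m + b → b < m → cliqueCount h L W ≤ blockCliques m a b
  cliqueCount≤blockCliques {m} degree W a b size b<m = <-rec Bounded bound (countᵇ W L) W refl a b size b<m
    where
    Bounded : ℕ → Set
    Bounded k = ∀ W → countᵇ W L ≡ k → ∀ a b → k ≡ a * m + b → b < m →
                cliqueCount h L W ≤ blockCliques m a b

    bound : ∀ k → (∀ {k′} → k′ < k → Bounded k′) → Bounded k
    bound k rec W refl a b size b<m with peel degree W
    ... | inj₁ empty = begin
      cliqueCount h L W              ≡⟨ cliqueSum-none h L W (const 1) empty ⟩
      1                              ≤⟨ m^n>0 2 b ⟩
      2 ^ b                          ≤⟨ m≤n+m (2 ^ b) _ ⟩
      blockCliques m a b             ∎
      where open ≤-Reasoning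
    ... | inj₂ (W′ , t , closed≤m , split , peeled)
      with blockCliques-peel m a b (suc t) (countᵇ W′ L) closed≤m b<m (trans (sym split) size)
    ...   | a′ , b′ , W′-size , b′<m , step = +-cancelʳ-≤ 1 _ _ (begin
      cliqueCount h L W + 1                 ≤⟨ peeled ⟩
      cliqueCount h L W′ + 2 ^ suc t        ≤⟨ +-monoˡ-≤ _ (rec smaller W′ refl a′ b′ W′-size b′<m) ⟩
      blockCliques m a′ b′ + 2 ^ suc t      ≤⟨ step ⟩
      blockCliques m a b + 1                ∎)
      where
      open ≤-Reasoning
      smaller : countᵇ W′ L < countᵇ W L
      smaller = ≤-trans (s≤s (m≤n+m (countᵇ W′ L) t)) (≤-reflexive (sym split))

-- Independent sets as cliques of the complement

tabulate-suc : ∀ n → tabulate {n = n} Fin.suc ≡ map Fin.suc (allFin n)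
tabulate-suc n = sym (map-tabulate id Fin.suc)

allᶠ : ∀ {n} → (Fin n → Bool) → Bool
allᶠ {zero}  f = true
allᶠ {suc n} f = f zero ∧ allᶠ (f ∘ suc)

all-tabulate : ∀ {n} (f : A → Bool) (g : Fin n → A) → all f (tabulate g) ≡ allᶠ (f ∘ g)
all-tabulate {n = zero}  f g = refl
all-tabulate {n = suc n} f g = cong (f (g zero) ∧_) (all-tabulate f (g ∘ suc))

allᶠ-cong : ∀ {n} {f g : Fin n → Bool} → (∀ i → f i ≡ g i) → allᶠ f ≡ allᶠ g
allᶠ-cong {zero}  e = refl
allᶠ-cong {suc n} e = cong₂ _∧_ (e zero) (allᶠ-cong (e ∘ suc))

allᶠ-∧ : ∀ {n} (f g : Fin n → Bool) → allᶠ (λ i → f i ∧ g i) ≡ allᶠ f ∧ allᶠ g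
allᶠ-∧ {zero}  f g = refl
allᶠ-∧ {suc n} f g =
  trans (cong ((f zero ∧ g zero) ∧_) (allᶠ-∧ (f ∘ suc) (g ∘ suc))) (∧.interchange (f zero) (g zero) _ _)

allᶠ-const-true : ∀ n → allᶠ {n} (const true) ≡ true
allᶠ-const-true zero    = refl
allᶠ-const-true (suc n) = allᶠ-const-true n

isIndependentᶠ : ∀ {n} → (Fin n → Fin n → Bool) → Subset n → Bool
isIndependentᶠ A S = allᶠ (λ u → allᶠ (λ v → not (lookup S u ∧ lookup S v ∧ A u v)))

_⊆ᵇ_ : ∀ {n} → Subset n → (Fin n → Bool) → Bool
S ⊆ᵇ p = allᶠ (λ u → not (lookup S u) ∨ p u)

isIndependent≡isIndependentᶠ : ∀ {n} (G : Graph n) S → isIndependent G S ≡ isIndependentᶠ (adj G) S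
isIndependent≡isIndependentᶠ {n} G S =
  trans (all-tabulate (λ u → all (row u) (allFin n)) id) (allᶠ-cong (λ u → all-tabulate (row u) id))
  where
  row : Fin n → Fin n → Bool
  row u v = not (lookup S u ∧ lookup S v ∧ adj G u v)

⊆ᵇ-∧ : ∀ {n} (S : Subset n) q r → (S ⊆ᵇ q) ∧ (S ⊆ᵇ r) ≡ S ⊆ᵇ (q ∧ₚ r)
⊆ᵇ-∧ S q r = trans (sym (allᶠ-∧ (λ u → not (lookup S u) ∨ q u) (λ u → not (lookup S u) ∨ r u)))
                   (allᶠ-cong (λ u → sym (∨-distribˡ-∧ (not (lookup S u)) (q u) (r u))))

⊆ᵇ-const-true : ∀ {n} (S : Subset n) → S ⊆ᵇ const true ≡ true
⊆ᵇ-const-true {n} S = trans (allᶠ-cong (λ u → ∨-zeroʳ (not (lookup S u)))) (allᶠ-const-true n)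

isIndependentᶠ-false∷ : ∀ {n} (A : Fin (suc n) → Fin (suc n) → Bool) S →
  isIndependentᶠ A (false ∷ S) ≡ isIndependentᶠ (A on suc) S
isIndependentᶠ-false∷ {n} A S =
  trans (cong (_∧ allᶠ (λ u → not (lookup S u ∧ false) ∧ rest u)) (allᶠ-const-true (suc n)))
        (allᶠ-cong (λ u → cong (λ b → not b ∧ rest u) (∧-zeroʳ (lookup S u))))
  where
  rest : Fin n → Bool
  rest u = allᶠ (λ v → not (lookup S u ∧ lookup S v ∧ A (suc u) (suc v)))

isIndependentᶠ-true∷ : ∀ {n} (A : Fin (suc n) → Fin (suc n) → Bool) → (∀ u v → A u v ≡ A v u) →
  A zero zero ≡ false → ∀ S →
  isIndependentᶠ A (true ∷ S) ≡ (S ⊆ᵇ (not ∘ A zero ∘ suc)) ∧ isIndependentᶠ (A on suc) S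
isIndependentᶠ-true∷ {n} A A-sym A-irrefl S = begin
  (not (A zero zero) ∧ row) ∧ allᶠ (λ u → column u ∧ rest u)
    ≡⟨ cong (λ b → (not b ∧ row) ∧ allᶠ (λ u → column u ∧ rest u)) A-irrefl ⟩
  row ∧ allᶠ (λ u → column u ∧ rest u)
    ≡⟨ cong (row ∧_) (allᶠ-∧ column rest) ⟩
  row ∧ (allᶠ column ∧ I)
    ≡⟨ cong (λ b → row ∧ (b ∧ I))
            (allᶠ-cong (λ u → cong (λ b → not (lookup S u ∧ b)) (A-sym (suc u) zero))) ⟩
  row ∧ (row ∧ I)
    ≡⟨ trans (sym (∧-assoc row row I)) (cong (_∧ I) (∧-idem row)) ⟩
  row ∧ I
    ≡⟨ cong (_∧ I) (allᶠ-cong (λ u → de-morgan (lookup S u) (A zero (suc u)))) ⟩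
  (S ⊆ᵇ (not ∘ A zero ∘ suc)) ∧ I ∎
  where
  open ≡-Reasoning
  row = allᶠ (λ v → not (lookup S v ∧ A zero (suc v)))
  column rest : Fin n → Bool
  column u = not (lookup S u ∧ A (suc u) zero)
  rest u = allᶠ (λ v → not (lookup S u ∧ lookup S v ∧ A (suc u) (suc v)))
  I = isIndependentᶠ (A on suc) S
  de-morgan : ∀ a b → not (a ∧ b) ≡ not a ∨ not b
  de-morgan true  b = refl
  de-morgan false b = refl

countᵇ-independent≡cliqueCount : ∀ n (A : Fin n → Fin n → Bool) → (∀ u v → A u v ≡ A v u) →
  (∀ u → A u u ≡ false) → (p : Fin n → Bool) →
  countᵇ (λ S → isIndependentᶠ A S ∧ (S ⊆ᵇ p)) (allSubsets n) ≡ cliqueCount (λ u v → not (A u v)) (allFin n) p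
countᵇ-independent≡cliqueCount zero    A A-sym A-irrefl p = refl
countᵇ-independent≡cliqueCount (suc n) A A-sym A-irrefl p = begin
  countᵇ P (map (false ∷_) subsets ++ map (true ∷_) subsets)
    ≡⟨ countᵇ-++ P (map (false ∷_) subsets) _ ⟩
  countᵇ P (map (false ∷_) subsets) + countᵇ P (map (true ∷_) subsets)
    ≡⟨ cong₂ _+_ (countᵇ-map P (false ∷_) subsets) (countᵇ-map P (true ∷_) subsets) ⟩
  countᵇ (P ∘ (false ∷_)) subsets + countᵇ (P ∘ (true ∷_)) subsets
    ≡⟨ cong₂ _+_ without-zero with-zero ⟩
  cliqueCount h′ (allFin n) (p ∘ suc) + (if p zero then cliqueCount h′ (allFin n) ((p ∧ₚ h zero) ∘ suc) else 0)
    ≡⟨ unfold-zero ⟩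
  cliqueCount h (allFin (suc n)) p ∎
  where
  open ≡-Reasoning
  P = λ S → isIndependentᶠ A S ∧ (S ⊆ᵇ p)
  subsets = allSubsets n
  h = λ u v → not (A u v)
  h′ = h on suc
  IH = countᵇ-independent≡cliqueCount n (A on suc) (λ u v → A-sym (suc u) (suc v)) (A-irrefl ∘ suc)

  without-zero : countᵇ (P ∘ (false ∷_)) subsets ≡ cliqueCount h′ (allFin n) (p ∘ suc)
  without-zero = trans (countᵇ-cong subsets (λ S → cong (_∧ (S ⊆ᵇ (p ∘ suc))) (isIndependentᶠ-false∷ A S)))
                       (IH (p ∘ suc))

  with-zero : countᵇ (P ∘ (true ∷_)) subsets
              ≡ (if p zero then cliqueCount h′ (allFin n) ((p ∧ₚ h zero) ∘ suc) else 0)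
  with-zero with p zero
  ... | false = countᵇ-none subsets (All.universal (λ S → ∧-zeroʳ (isIndependentᶠ A (true ∷ S))) subsets)
  ... | true  = trans (countᵇ-cong subsets reorder) (IH ((p ∧ₚ h zero) ∘ suc))
    where
    reorder : ∀ S → isIndependentᶠ A (true ∷ S) ∧ (S ⊆ᵇ (p ∘ suc))
                    ≡ isIndependentᶠ (A on suc) S ∧ (S ⊆ᵇ ((p ∧ₚ h zero) ∘ suc))
    reorder S = begin
      isIndependentᶠ A (true ∷ S) ∧ (S ⊆ᵇ (p ∘ suc))
        ≡⟨ cong (_∧ (S ⊆ᵇ (p ∘ suc))) (isIndependentᶠ-true∷ A A-sym (A-irrefl zero) S) ⟩
      ((S ⊆ᵇ (h zero ∘ suc)) ∧ isIndependentᶠ (A on suc) S) ∧ (S ⊆ᵇ (p ∘ suc))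
        ≡⟨ ∧.xy∙z≈y∙zx (S ⊆ᵇ (h zero ∘ suc)) _ _ ⟩
      isIndependentᶠ (A on suc) S ∧ ((S ⊆ᵇ (p ∘ suc)) ∧ (S ⊆ᵇ (h zero ∘ suc)))
        ≡⟨ cong (isIndependentᶠ (A on suc) S ∧_) (⊆ᵇ-∧ S (p ∘ suc) (h zero ∘ suc)) ⟩
      isIndependentᶠ (A on suc) S ∧ (S ⊆ᵇ ((p ∧ₚ h zero) ∘ suc)) ∎

  on-tail : ∀ q → cliqueCount h (tabulate {n = n} suc) q ≡ cliqueCount h′ (allFin n) (q ∘ suc)
  on-tail q = trans (cong (λ xs → cliqueCount h xs q) (tabulate-suc n)) (cliqueCount-map h suc (allFin n) q)

  unfold-zero : cliqueCount h′ (allFin n) (p ∘ suc)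
                + (if p zero then cliqueCount h′ (allFin n) ((p ∧ₚ h zero) ∘ suc) else 0)
                ≡ cliqueCount h (allFin (suc n)) p
  unfold-zero with p zero
  ... | true  = sym (cong₂ _+_ (on-tail p) (on-tail (p ∧ₚ h zero)))
  ... | false = trans (+-identityʳ _) (sym (on-tail p))

-- The disjoint union of cliques a K_m ∪ K_b

iterate-suc-++ : ∀ s k l → iterate suc s (k + l) ≡ iterate suc s k ++ iterate suc (s + k) l
iterate-suc-++ s zero    l = cong (λ t → iterate suc t l) (sym (+-identityʳ s))
iterate-suc-++ s (suc k) l =
  cong (s ∷_) (trans (iterate-suc-++ (suc s) k l) (cong (λ t → iterate suc (suc s) k ++ iterate suc t l) (sym (+-suc s k))))

iterate-suc-bounds : ∀ s l → All (λ x → s ≤ x × x < s + l) (iterate suc s l)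
iterate-suc-bounds s zero    = []
iterate-suc-bounds s (suc l) =
  (≤-refl , subst (s <_) (sym (+-suc s l)) (s≤s (m≤m+n s l)))
  ∷ All.map (λ {x} (lo , hi) → <⇒≤ lo , subst (x <_) (sym (+-suc s l)) hi) (iterate-suc-bounds (suc s) l)

module Blocks (m : ℕ) .{{_ : NonZero m}} where

  sameBlock : ℕ → ℕ → Bool
  sameBlock x y = does (x / m ≟ y / m)

  block-of : ∀ j x → j * m ≤ x → x < j * m + m → x / m ≡ j
  block-of j x lo hi = ≤-antisym (≤-pred (m<n*o⇒m/o<n (subst (x <_) (+-comm (j * m) m) hi)))
                                 (subst (_≤ x / m) (m*n/n≡m j m) (/-monoˡ-≤ m lo))

  later-block : ∀ j x → suc j * m ≤ x → j < x / m
  later-block j x lo = subst (_≤ x / m) (m*n/n≡m (suc j) m) (/-monoˡ-≤ m lo)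

  cliqueCount-block : ∀ j l → l ≤ m → cliqueCount sameBlock (iterate suc (j * m) l) (const true) ≡ 2 ^ l
  cliqueCount-block j l l≤m =
    trans (cliqueCount-complete sameBlock (λ x → x / m ≡ j)
             (λ {x} {y} ex ey → dec-true (x / m ≟ y / m) (trans ex (sym ey)))
             (iterate suc (j * m) l)
             (All.map (λ {x} (lo , hi) → block-of j x lo (≤-trans hi (+-monoʳ-≤ (j * m) l≤m)))
                      (iterate-suc-bounds (j * m) l)))
          (cong (2 ^_) (length-iterate suc (j * m) l))

  cliqueCount-blocks : ∀ a j b → b < m →
    cliqueCount sameBlock (iterate suc (j * m) (a * m + b)) (const true) ≡ blockCliques m a b
  cliqueCount-blocks zero    j b b<m = cliqueCount-block j b (<⇒≤ b<m)
  cliqueCount-blocks (suc a) j b b<m = +-cancelʳ-≡ 1 _ _ (begin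
    cliqueCount sameBlock (iterate suc (j * m) (m + a * m + b)) all′ + 1
      ≡⟨ cong (λ xs → cliqueCount sameBlock xs all′ + 1) split ⟩
    cliqueCount sameBlock (first ++ others) all′ + 1
      ≡⟨ cliqueCount-++ sameBlock first others all′ apart ⟩
    cliqueCount sameBlock first all′ + cliqueCount sameBlock others all′
      ≡⟨ cong₂ _+_ (cliqueCount-block j m ≤-refl) (cliqueCount-blocks a (suc j) b b<m) ⟩
    2 ^ m + (a * K + 2 ^ b)
      ≡⟨ cong (_+ (a * K + 2 ^ b)) (sym (m∸n+n≡m (m^n>0 2 m))) ⟩
    K + 1 + (a * K + 2 ^ b)
      ≡⟨ e K (a * K) (2 ^ b) ⟩
    K + a * K + 2 ^ b + 1 ∎)
    where
    open ≡-Reasoning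
    all′ : ℕ → Bool
    all′ = const true
    K = 2 ^ m ∸ 1
    first = iterate suc (j * m) m
    others = iterate suc (suc j * m) (a * m + b)
    e : ∀ k x y → k + 1 + (x + y) ≡ k + x + y + 1
    e = solve-∀
    split : iterate suc (j * m) (m + a * m + b) ≡ first ++ others
    split = trans (cong (iterate suc (j * m)) (+-assoc m (a * m) b))
                  (trans (iterate-suc-++ (j * m) m (a * m + b))
                         (cong (λ s → first ++ iterate suc s (a * m + b)) (+-comm (j * m) m)))
    apart : All (λ x → All (λ y → sameBlock x y ≡ false) others) first
    apart = All.map (λ {x} (lo , hi) → All.map (λ {y} (lo′ , _) →
              dec-false (x / m ≟ y / m) (λ same → <-irrefl (trans (sym (block-of j x lo hi)) same) (later-block j y lo′)))
              (iterate-suc-bounds (suc j * m) (a * m + b)))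
              (iterate-suc-bounds (j * m) m)

allFin-enumerates : ∀ n → Equalityᵇ.Enumerates (Finₚ._≟_ {n}) (allFin n)
allFin-enumerates (suc n) v = trans (cong (countᵇ (_≡ᵇ v)) (cong (zero ∷_) (tabulate-suc n))) (at v)
  where
  open Equalityᵇ (Finₚ._≟_ {suc n})
  at : ∀ v → countᵇ (_≡ᵇ v) (zero ∷ map suc (allFin n)) ≡ 1
  at zero    = cong suc (trans (countᵇ-map _ suc (allFin n)) (countᵇ-none (allFin n) (All.universal (λ _ → refl) _)))
  at (suc v) = trans (countᵇ-map _ suc (allFin n)) (allFin-enumerates n v)

countᵇ-allFin : ∀ n → countᵇ (const true) (allFin n) ≡ n
countᵇ-allFin n = trans (countᵇ-const-true (allFin n)) (length-tabulate id)

map-toℕ-allFin : ∀ n → map toℕ (allFin n) ≡ iterate suc 0 n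
map-toℕ-allFin n = trans (map-tabulate id toℕ) (tabulate-toℕ n 0)
  where
  tabulate-toℕ : ∀ n s → tabulate (λ (i : Fin n) → s + toℕ i) ≡ iterate suc s n
  tabulate-toℕ zero    s = refl
  tabulate-toℕ (suc n) s =
    cong₂ _∷_ (+-identityʳ s) (trans (tabulate-cong (λ i → +-suc s (toℕ i))) (tabulate-toℕ n (suc s)))

i≡cliqueCount : ∀ {n} (G : Graph n) → i G ≡ cliqueCount (λ u v → not (adj G u v)) (allFin n) (const true)
i≡cliqueCount {n} G = begin
  i G
    ≡⟨ sym (countᵇ≡length∘filterᵇ (isIndependent G) (allSubsets n)) ⟩
  countᵇ (isIndependent G) (allSubsets n)
    ≡⟨ countᵇ-cong (allSubsets n) inside-everything ⟩
  countᵇ (λ S → isIndependentᶠ (adj G) S ∧ (S ⊆ᵇ const true)) (allSubsets n)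
    ≡⟨ countᵇ-independent≡cliqueCount n (adj G) (adj-sym G) (irrefl G) (const true) ⟩
  cliqueCount (λ u v → not (adj G u v)) (allFin n) (const true) ∎
  where
  open ≡-Reasoning
  inside-everything : ∀ S → isIndependent G S ≡ isIndependentᶠ (adj G) S ∧ (S ⊆ᵇ const true)
  inside-everything S = trans (isIndependent≡isIndependentᶠ G S)
                              (sym (trans (cong (isIndependentᶠ (adj G) S ∧_) (⊆ᵇ-const-true S)) (∧-identityʳ _)))

i-complement-cliqueBlocks : ∀ n m a b → n ≡ a * suc m + b → b < suc m →
  i (complement (cliqueBlocks n (suc m))) ≡ blockCliques (suc m) a b
i-complement-cliqueBlocks n m a b split b<m = begin
  i (complement (cliqueBlocks n (suc m)))
    ≡⟨ i≡cliqueCount (complement (cliqueBlocks n (suc m))) ⟩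
  cliqueCount h (allFin n) (const true)
    ≡⟨ cliqueSum-congʰ same-block (allFin n) (const true) (const 1) ⟩
  cliqueCount (sameBlock on toℕ) (allFin n) (const true)
    ≡⟨ sym (cliqueCount-map sameBlock toℕ (allFin n) (const true)) ⟩
  cliqueCount sameBlock (map toℕ (allFin n)) (const true)
    ≡⟨ cong (λ xs → cliqueCount sameBlock xs (const true)) (map-toℕ-allFin n) ⟩
  cliqueCount sameBlock (iterate suc 0 n) (const true)
    ≡⟨ cong (λ k → cliqueCount sameBlock (iterate suc 0 k) (const true)) split ⟩
  cliqueCount sameBlock (iterate suc 0 (a * suc m + b)) (const true)
    ≡⟨ cliqueCount-blocks a 0 b b<m ⟩
  blockCliques (suc m) a b ∎
  where
  open ≡-Reasoning
  open Blocks (suc m)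
  h = λ u v → not (adj (complement (cliqueBlocks n (suc m))) u v)
  same-block : ∀ u v → h u v ≡ sameBlock (toℕ u) (toℕ v)
  same-block u v with u Finₚ.≟ v
  ... | yes refl = sym (dec-true (toℕ u / suc m ≟ toℕ u / suc m) refl)
  ... | no _     = trans (not-involutive _) (isYes≗does (toℕ u / suc m ≟ toℕ v / suc m))

nonNeighbours≤ : ∀ {n d} (G : Graph n) → MinDegreeAtLeast G d → ∀ v → countᵇ (not ∘ adj G v) (allFin n) ≤ n ∸ d
nonNeighbours≤ {n} {d} G δ≥d v = subst (_≤ n ∸ d) n∸degree (∸-monoʳ-≤ n (δ≥d v))
  where
  n∸degree : n ∸ degree G v ≡ countᵇ (not ∘ adj G v) (allFin n)
  n∸degree = begin
    n ∸ degree G v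
      ≡⟨ cong (_∸ degree G v) (sym (countᵇ-allFin n)) ⟩
    countᵇ (const true) (allFin n) ∸ degree G v
      ≡⟨ cong₂ _∸_ (countᵇ-split (const true) (adj G v) (allFin n))
                   (sym (countᵇ≡length∘filterᵇ (adj G v) (allFin n))) ⟩
    countᵇ (adj G v) (allFin n) + countᵇ (not ∘ adj G v) (allFin n) ∸ countᵇ (adj G v) (allFin n)
      ≡⟨ m+n∸m≡n (countᵇ (adj G v) (allFin n)) _ ⟩
    countᵇ (not ∘ adj G v) (allFin n) ∎
    where open ≡-Reasoning

cliqueBlocks-extremal : ∀ n m a b → n ≡ a * m + b → b < m → (G : Graph n) →
  (∀ v → countᵇ (not ∘ adj G v) (allFin n) ≤ m) →
  (i G ≤ i (complement (cliqueBlocks n m))) × (i (complement (cliqueBlocks n m)) ≡ blockCliques m a b)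
cliqueBlocks-extremal n zero    a b split ()  G nonNeighbours
cliqueBlocks-extremal n (suc m) a b split b<m G nonNeighbours =
  subst (i G ≤_) (sym extremal-count) (subst (_≤ blockCliques (suc m) a b) (sym (i≡cliqueCount G)) bound) ,
  extremal-count
  where
  extremal-count = i-complement-cliqueBlocks n m a b split b<m
  bound : cliqueCount (λ u v → not (adj G u v)) (allFin n) (const true) ≤ blockCliques (suc m) a b
  bound = Peeling.cliqueCount≤blockCliques (Finₚ._≟_ {n}) (λ u v → not (adj G u v))
            (λ u v → cong not (adj-sym G u v)) (λ u → cong not (irrefl G u)) (allFin n) (allFin-enumerates n)
            nonNeighbours (const true) a b (trans (countᵇ-allFin n) split) b<m

mainTheorem2 : (n d a b : ℕ) → n ≡ a * (n ∸ d) + b → b < n ∸ d →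
               (G : Graph n) → MinDegreeAtLeast G d →
               (i G ≤ i (complement (cliqueBlocks n (n ∸ d))))
               × (i (complement (cliqueBlocks n (n ∸ d))) ≡ a * (2 ^ (n ∸ d) ∸ 1) + 2 ^ b)
mainTheorem2 n d a b split b<n∸d G δ≥d =
  cliqueBlocks-extremal n (n ∸ d) a b split b<n∸d G (nonNeighbours≤ G δ≥d)
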